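{- For integers $2\le m\le n$, $strc(K_{m,n})=\lceil \sqrt[m]{n}\,\rceil+1$.
   Context: All graphs are finite and simple; $K_{m,n}$ is the complete bipartite graph with class sizes $m$ and $n$. A total-coloured path (vertices and edges coloured) is total-rainbow if its edges and internal vertices have pairwise distinct colours. $strc(G)$ is the minimum number of colours in a total-colouring of $G$ in which any two vertices $u,v$ are joined by a total-rainbow $u$–$v$ geodesic (a $u$–$v$ path of length $d(u,v)$). -}

module Defs where

open import Data.Nat using (ℕ; zero; suc; _≤_; _^_)
open import Data.Fin using (Fin)
open import Data.Sum using (_⊎_; inj₁; inj₂)
open import Data.Product using (Σ; _×_; _,_)
open import Data.Unit using (⊤)
open import Data.Empty using (⊥)
open import Data.List using (List; []; _∷_; _++_; map)
open import Data.List.Relation.Unary.Unique.Propositional using (Unique)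
open import Relation.Binary.PropositionalEquality using (_≡_)

module _ {V : Set} (E : V → V → Set) where

  data Walk : V → V → Set where
    stop : (u : V) → Walk u u
    step : {u w v : V} → E u w → Walk w v → Walk u v

  len : {u v : V} → Walk u v → ℕ
  len (stop _) = 0
  len (step _ p) = suc (len p)

  vertices : {u v : V} → Walk u v → List V
  vertices (stop u) = u ∷ []
  vertices (step {u} _ p) = u ∷ vertices p

  allButLast : {u v : V} → Walk u v → List V
  allButLast (stop _) = []
  allButLast (step {u} _ p) = u ∷ allButLast p

  internal : {u v : V} → Walk u v → List V
  internal (stop _) = []
  internal (step _ p) = allButLast p

  IsPath : {u v : V} → Walk u v → Set
  IsPath p = Unique (vertices p)

  IsGeodesic : {u v : V} → Walk u v → Set
  IsGeodesic {u} {v} p = IsPath p × ((q : Walk u v) → len p ≤ len q)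

  module _ {C : Set} (cV : V → C) (cE : V → V → C) where

    edgeColours : {u v : V} → Walk u v → List C
    edgeColours (stop _) = []
    edgeColours (step {u} {w} _ p) = cE u w ∷ edgeColours p

    TotalRainbow : {u v : V} → Walk u v → Set
    TotalRainbow p = Unique (edgeColours p ++ map cV (internal p))

    StrongTotalRainbowConnected : Set
    StrongTotalRainbowConnected =
      (u v : V) → Σ (Walk u v) (λ p → IsGeodesic p × TotalRainbow p)

  -- A total colouring with k colours: vertex colours and edge colours in Fin k.
  -- Edge colours are given by a symmetric function on pairs of vertices
  -- (only its values on edges matter).
  record TotalColouring (k : ℕ) : Set where
    field
      vcol : V → Fin k
      ecol : V → V → Fin k
      ecol-sym : (x y : V) → ecol x y ≡ ecol y x

  IsSTRC : {k : ℕ} → TotalColouring k → Set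
  IsSTRC c = StrongTotalRainbowConnected (TotalColouring.vcol c) (TotalColouring.ecol c)

  StrcIs : ℕ → Set
  StrcIs k = Σ (TotalColouring k) IsSTRC
           × ((k' : ℕ) → Σ (TotalColouring k') IsSTRC → k ≤ k')

KAdj : (m n : ℕ) → Fin m ⊎ Fin n → Fin m ⊎ Fin n → Set
KAdj m n (inj₁ _) (inj₁ _) = ⊥
KAdj m n (inj₁ _) (inj₂ _) = ⊤
KAdj m n (inj₂ _) (inj₁ _) = ⊤
KAdj m n (inj₂ _) (inj₂ _) = ⊥

IsCeilRoot : (m n c : ℕ) → Set
IsCeilRoot m n c = (n ≤ c ^ m) × ((c' : ℕ) → n ≤ c' ^ m → c ≤ c')

module Submission where

-- Two vertices of the same class of K_{m,n} are at distance 2, so a total-rainbow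
-- geodesic between them is a path u – x – v whose two edge colours and the colour
-- of x are pairwise distinct ('RainbowCorner').
--
-- Lower bound.  Take a strong total-rainbow connected colouring with k colours;
-- a rainbow corner shows k ≥ 2.  For each vertex b of the n-class record, for
-- every a_i, the colour of the edge b a_i with the colour of a_i deleted: a word
-- of length m over Fin (k-1).  A rainbow corner between b and b' at a_i makes
-- the words of b and b' differ at i, so n ≤ (k-1)^m and hence c ≤ k - 1.
--
-- Upper bound.  A 'SeparatingMatrix' (an n × m matrix over Fin c with pairwise
-- distinct rows and pairwise distinct columns) yields a colouring with c + 1
-- colours: all vertices get 0 and the edge a_i b gets 1 + (entry b i).  Such a
-- matrix exists when m ≤ n ≤ c^m and c ≥ 2: take the words of length m over Fin c
-- coded by 0, …, n-1, after swapping the codes 0, …, m-1 with the codes of the m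
-- threshold words (1 on the coordinates ≤ k, 0 elsewhere), whose columns differ.

open import Defs
open import Data.Nat using (ℕ; zero; suc; _≤_; _<_; _+_; _*_; _^_; z≤n; s≤s)
open import Data.Nat.Properties
  using (≤-trans; ≤-reflexive; <-≤-trans; <⇒≱; m≤m+n; n<1+n; *-identityʳ; ^-zeroˡ; ^-monoʳ-<)
open import Data.Fin using (Fin; zero; suc; toℕ; inject≤; punchOut; funToFin; finToFun; combine)
  renaming (_≤_ to _≤ᶠ_; _<_ to _<ᶠ_)
open import Data.Fin.Properties
  using (_≟_; _≤?_; <-cmp; toℕ<n; suc-injective; toℕ-combine; toℕ-inject≤; inject≤-injective; inject≤-trans;
         punchOut-injective; funToFin-finToFin; finToFun-funToFin; injective⇒≤; all?; any?; ¬∀⟶∃¬)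
  renaming (<⇒≢ to <ᶠ⇒≢)
open import Data.Sum using (_⊎_; inj₁; inj₂)
open import Data.Sum.Properties using (inj₁-injective; inj₂-injective)
open import Data.Product using (Σ; ∃; _×_; _,_)
open import Data.Unit using (tt)
open import Data.List using ([])
open import Data.List.Relation.Unary.AllPairs using ([]; _∷_)
open import Data.List.Relation.Unary.All using ([]; _∷_)
open import Function using (_∘_)
open import Relation.Nullary using (¬_; Dec; yes; no; contradiction)
open import Relation.Binary using (DecidableEquality; tri<; tri≈; tri>)
open import Relation.Binary.PropositionalEquality using (_≡_; _≢_; refl; sym; trans; cong; cong₂)

-- Words of length m over Fin c and their codes in Fin (c ^ m)

funToFin-cong : ∀ {m c} {f g : Fin m → Fin c} → (∀ i → f i ≡ g i) → funToFin f ≡ funToFin g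
funToFin-cong {zero}  f≗g = refl
funToFin-cong {suc m} f≗g = cong₂ combine (f≗g zero) (funToFin-cong (f≗g ∘ suc))

funToFin-injective : ∀ {m c} {f g : Fin m → Fin c} → funToFin f ≡ funToFin g → ∀ i → f i ≡ g i
funToFin-injective {f = f} {g} eq i =
  trans (sym (finToFun-funToFin f i)) (trans (cong (λ x → finToFun x i) eq) (finToFun-funToFin g i))

finToFun-separates : ∀ {m c} {x y : Fin (c ^ m)} → x ≢ y → ∃ λ i → finToFun x i ≢ finToFun y i
finToFun-separates {m} {c} {x} {y} x≢y with all? (λ i → finToFun x i ≟ finToFun y i)
... | no  ¬all = ¬∀⟶∃¬ m _ (λ i → finToFun x i ≟ finToFun y i) ¬all
... | yes all  = contradiction decodes-equal x≢y
  where
    decodes-equal : x ≡ y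
    decodes-equal = trans (sym (funToFin-finToFin {m} {c} x)) (trans (funToFin-cong all) (funToFin-finToFin {m} {c} y))

-- A word whose first letter is 1 has code at least c^m: codes are read most
-- significant letter first.
code-leading-one : ∀ {m c} (f : Fin (suc m) → Fin (suc (suc c))) → f zero ≡ suc zero →
                   suc (suc c) ^ m ≤ toℕ (funToFin f)
code-leading-one {m} {c} f f₀≡1 = ≤-trans lead≤ (≤-reflexive (sym (toℕ-combine (f zero) (funToFin (f ∘ suc)))))
  where
    lead≤ : suc (suc c) ^ m ≤ suc (suc c) ^ m * toℕ (f zero) + toℕ (funToFin (f ∘ suc))
    lead≤ rewrite f₀≡1 | *-identityʳ (suc (suc c) ^ m) = m≤m+n _ _

<-pow : ∀ C → 1 < C → ∀ k → suc k ≤ C ^ k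
<-pow C 1<C zero    = s≤s z≤n
<-pow C 1<C (suc k) = ≤-trans (s≤s (<-pow C 1<C k)) (^-monoʳ-< C 1<C (n<1+n k))

distinct⇒2≤ : ∀ {k} {x y : Fin k} → x ≢ y → 2 ≤ k
distinct⇒2≤ {suc zero}    {zero} {zero} x≢y = contradiction refl x≢y
distinct⇒2≤ {suc (suc _)} _                 = s≤s (s≤s z≤n)

base≥2 : ∀ {n c} m → 2 ≤ n → n ≤ c ^ suc m → 2 ≤ c
base≥2 {c = zero}        m (s≤s _) ()
base≥2 {c = suc zero}    m 2≤n n≤1ᵐ with ≤-trans 2≤n (≤-trans n≤1ᵐ (≤-reflexive (^-zeroˡ (suc m))))
... | s≤s ()
base≥2 {c = suc (suc _)} _ _ _ = s≤s (s≤s z≤n)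

-- Deleting the colour p: Fin (2+q) without p is squeezed into Fin (1+q)
-- (p itself goes to 0; only its behaviour away from p matters).
squash : ∀ {q} → Fin (suc (suc q)) → Fin (suc (suc q)) → Fin (suc q)
squash p x with p ≟ x
... | yes _   = zero
... | no  p≢x = punchOut p≢x

squash-injective : ∀ {q} {p x y : Fin (suc (suc q))} → p ≢ x → p ≢ y → squash p x ≡ squash p y → x ≡ y
squash-injective {p = p} {x} {y} p≢x p≢y eq with p ≟ x | p ≟ y
... | yes p≡x | _       = contradiction p≡x p≢x
... | no  _   | yes p≡y = contradiction p≡y p≢y
... | no  p≢x′ | no p≢y′ = punchOut-injective p≢x′ p≢y′ eq

module Swap {X : Set} (_≟X_ : DecidableEquality X) {m : ℕ} (f g : Fin m → X)
            (f-injective : ∀ {k k'} → f k ≡ f k' → k ≡ k')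
            (g-injective : ∀ {k k'} → g k ≡ g k' → k ≡ k')
            (disjoint : ∀ k k' → f k ≢ g k') where

  InImage : (Fin m → X) → X → Set
  InImage h x = ∃ λ k → h k ≡ x

  inImage? : (h : Fin m → X) (x : X) → Dec (InImage h x)
  inImage? h x = any? (λ k → h k ≟X x)

  swapBy : (x : X) → Dec (InImage f x) → Dec (InImage g x) → X
  swapBy x (yes (k , _)) _             = g k
  swapBy x (no _)        (yes (k , _)) = f k
  swapBy x (no _)        (no _)        = x

  swap : X → X
  swap x = swapBy x (inImage? f x) (inImage? g x)

  swap-f : ∀ k → swap (f k) ≡ g k
  swap-f k = go (inImage? f (f k)) (inImage? g (f k))
    where
      go : (d : Dec (InImage f (f k))) (e : Dec (InImage g (f k))) → swapBy (f k) d e ≡ g k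
      go (yes (k' , fk'≡fk)) _ = cong g (f-injective fk'≡fk)
      go (no ¬f)             _ = contradiction (k , refl) ¬f

  swap-g : ∀ k → swap (g k) ≡ f k
  swap-g k = go (inImage? f (g k)) (inImage? g (g k))
    where
      go : (d : Dec (InImage f (g k))) (e : Dec (InImage g (g k))) → swapBy (g k) d e ≡ f k
      go (yes (k' , fk'≡gk)) _                   = contradiction fk'≡gk (disjoint k' k)
      go (no _)              (yes (k' , gk'≡gk)) = cong f (g-injective gk'≡gk)
      go (no _)              (no ¬g)             = contradiction (k , refl) ¬g

  swap-other : ∀ {x} → ¬ InImage f x → ¬ InImage g x → swap x ≡ x
  swap-other {x} ¬f ¬g = go (inImage? f x) (inImage? g x)
    where
      go : (d : Dec (InImage f x)) (e : Dec (InImage g x)) → swapBy x d e ≡ x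
      go (yes p) _       = contradiction p ¬f
      go (no _)  (yes p) = contradiction p ¬g
      go (no _)  (no _)  = refl

  swap-involutive : ∀ x → swap (swap x) ≡ x
  swap-involutive x = go x (inImage? f x) (inImage? g x)
    where
      go : ∀ y → Dec (InImage f y) → Dec (InImage g y) → swap (swap y) ≡ y
      go _ (yes (k , refl)) _              = trans (cong swap (swap-f k)) (swap-g k)
      go _ (no _)           (yes (k , refl)) = trans (cong swap (swap-g k)) (swap-f k)
      go _ (no ¬f)          (no ¬g)          = trans (cong swap (swap-other ¬f ¬g)) (swap-other ¬f ¬g)

  swap-injective : ∀ {x y} → swap x ≡ swap y → x ≡ y
  swap-injective {x} {y} eq = trans (sym (swap-involutive x)) (trans (cong swap eq) (swap-involutive y))

-- Rainbow geodesics of length at most two, in an arbitrary graph.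

module _ {V : Set} (E : V → V → Set) where

  walk-length-≥1 : ∀ {u v} → u ≢ v → (q : Walk E u v) → 1 ≤ len E q
  walk-length-≥1 u≢v (stop _)   = contradiction refl u≢v
  walk-length-≥1 u≢v (step _ _) = s≤s z≤n

  walk-length-≥2 : ∀ {u v} → u ≢ v → ¬ E u v → (q : Walk E u v) → 2 ≤ len E q
  walk-length-≥2 u≢v ¬uv (stop _)            = contradiction refl u≢v
  walk-length-≥2 u≢v ¬uv (step e (stop _))   = contradiction e ¬uv
  walk-length-≥2 u≢v ¬uv (step _ (step _ _)) = s≤s (s≤s z≤n)

  module _ {C : Set} (cV : V → C) (cE : V → V → C) where

    RainbowGeodesic : V → V → Set
    RainbowGeodesic u v = Σ (Walk E u v) λ p → IsGeodesic E p × TotalRainbow E cV cE p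

    RainbowCorner : V → V → V → Set
    RainbowCorner u x v = cE u x ≢ cE x v × cE u x ≢ cV x × cE x v ≢ cV x

    trivial-geodesic : ∀ u → RainbowGeodesic u u
    trivial-geodesic u = stop u , ([] ∷ [] , λ _ → z≤n) , []

    edge-geodesic : ∀ {u v} → u ≢ v → E u v → RainbowGeodesic u v
    edge-geodesic {v = v} u≢v e =
      step e (stop v) , ((u≢v ∷ []) ∷ [] ∷ [] , walk-length-≥1 u≢v) , [] ∷ []

    corner-geodesic : ∀ {u x v} → u ≢ v → ¬ E u v → u ≢ x → x ≢ v → E u x → E x v →
                      RainbowCorner u x v → RainbowGeodesic u v
    corner-geodesic {v = v} u≢v ¬uv u≢x x≢v e e' (c₁₂ , c₁₃ , c₂₃) =
      step e (step e' (stop v)) ,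
      ((u≢x ∷ u≢v ∷ []) ∷ (x≢v ∷ []) ∷ [] ∷ [] , walk-length-≥2 u≢v ¬uv) ,
      (c₁₂ ∷ c₁₃ ∷ []) ∷ (c₂₃ ∷ []) ∷ [] ∷ []

    geodesic-corner : ∀ {u w v} → u ≢ v → ¬ E u v → E u w → E w v → RainbowGeodesic u v →
                      ∃ λ x → E u x × RainbowCorner u x v
    geodesic-corner u≢v ¬uv _ _ (stop _ , _) = contradiction refl u≢v
    geodesic-corner u≢v ¬uv _ _ (step e (stop _) , _) = contradiction e ¬uv
    geodesic-corner u≢v ¬uv _ _ (step {w = x} e (step _ (stop _)) , _ ,
                                 (c₁₂ ∷ c₁₃ ∷ []) ∷ (c₂₃ ∷ []) ∷ [] ∷ []) = x , e , c₁₂ , c₁₃ , c₂₃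
    geodesic-corner {v = v} u≢v ¬uv e e' (step _ (step _ (step _ _)) , (_ , shortest) , _)
      with shortest (step e (step e' (stop v)))
    ... | s≤s (s≤s ())

-- Lower bound: a strong total-rainbow connected colouring of K_{m,n}
-- with k colours has k ≥ 2 and n ≤ (k-1)^m.

module _ {m n k : ℕ} (col : TotalColouring (KAdj m n) k) (strc : IsSTRC (KAdj m n) col) where
  open TotalColouring col

  corner-between : Fin m → (b b' : Fin n) → b ≢ b' →
                   ∃ λ i → RainbowCorner (KAdj m n) vcol ecol (inj₂ b) (inj₁ i) (inj₂ b')
  corner-between a b b' b≢b'
    with geodesic-corner (KAdj m n) vcol ecol {w = inj₁ a} (b≢b' ∘ inj₂-injective) (λ ()) tt tt (strc (inj₂ b) (inj₂ b'))
  ... | inj₁ i , _ , corner = i , corner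

  -- the two edge colours of such a corner are distinct colours
  at-least-two-colours : Fin m → (b b' : Fin n) → b ≢ b' → 2 ≤ k
  at-least-two-colours a b b' b≢b' with corner-between a b b' b≢b'
  ... | _ , c₁₂ , _ = distinct⇒2≤ c₁₂

module _ {m n q : ℕ} (col : TotalColouring (KAdj m n) (suc (suc q)))
         (strc : IsSTRC (KAdj m n) col) where
  open TotalColouring col

  colour-word : Fin n → Fin m → Fin (suc q)
  colour-word b i = squash (vcol (inj₁ i)) (ecol (inj₂ b) (inj₁ i))

  -- distinct vertices have distinct words: compare them at their rainbow corner
  colour-word-injective : Fin m → ∀ {b b'} → (∀ i → colour-word b i ≡ colour-word b' i) → b ≡ b'
  colour-word-injective a {b} {b'} same with b ≟ b'
  ... | yes b≡b' = b≡b'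
  ... | no  b≢b' with corner-between col strc a b b' b≢b'
  ... | i , c₁₂ , c₁₃ , c₂₃ = contradiction (trans equal-edges (ecol-sym (inj₂ b') (inj₁ i))) c₁₂
    where
      equal-edges : ecol (inj₂ b) (inj₁ i) ≡ ecol (inj₂ b') (inj₁ i)
      equal-edges = squash-injective (c₁₃ ∘ sym) (c₂₃ ∘ trans (ecol-sym (inj₁ i) (inj₂ b')) ∘ sym) (same i)

  colour-count : Fin m → n ≤ suc q ^ m
  colour-count a = injective⇒≤ (colour-word-injective a ∘ funToFin-injective)

-- Upper bound.

record SeparatingMatrix (m n c : ℕ) : Set where
  field
    entry            : Fin n → Fin m → Fin c
    rows-distinct    : ∀ {b b'} → b ≢ b' → ∃ λ i → entry b i ≢ entry b' i
    columns-distinct : ∀ {i j} → i ≢ j → ∃ λ b → entry b i ≢ entry b j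

-- Colour every vertex 0 and the edge a_i b with 1 + entry b i: distinct columns
-- give rainbow corners between A-vertices, distinct rows between B-vertices.
matrix-colouring : ∀ {m n c} → SeparatingMatrix m n c → Σ (TotalColouring (KAdj m n) (suc c)) (IsSTRC (KAdj m n))
matrix-colouring {m} {n} {c} S = record { vcol = λ _ → zero ; ecol = ecol ; ecol-sym = ecol-sym } , connected
  where
    open SeparatingMatrix S

    ecol : Fin m ⊎ Fin n → Fin m ⊎ Fin n → Fin (suc c)
    ecol (inj₁ i) (inj₂ b) = suc (entry b i)
    ecol (inj₂ b) (inj₁ i) = suc (entry b i)
    ecol _        _        = zero

    ecol-sym : ∀ x y → ecol x y ≡ ecol y x
    ecol-sym (inj₁ _) (inj₁ _) = refl
    ecol-sym (inj₁ _) (inj₂ _) = refl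
    ecol-sym (inj₂ _) (inj₁ _) = refl
    ecol-sym (inj₂ _) (inj₂ _) = refl

    connected : ∀ u v → RainbowGeodesic (KAdj m n) (λ _ → zero) ecol u v
    connected (inj₁ i) (inj₂ b) = edge-geodesic (KAdj m n) _ ecol (λ ()) tt
    connected (inj₂ b) (inj₁ i) = edge-geodesic (KAdj m n) _ ecol (λ ()) tt
    connected (inj₁ i) (inj₁ j) with i ≟ j
    ... | yes refl = trivial-geodesic (KAdj m n) _ ecol (inj₁ i)
    ... | no  i≢j with columns-distinct i≢j
    ... | b , differ = corner-geodesic (KAdj m n) _ ecol {x = inj₂ b} (i≢j ∘ inj₁-injective) (λ ()) (λ ()) (λ ()) tt tt
                         (differ ∘ suc-injective , (λ ()) , (λ ()))
    connected (inj₂ b) (inj₂ b') with b ≟ b'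
    ... | yes refl = trivial-geodesic (KAdj m n) _ ecol (inj₂ b)
    ... | no  b≢b' with rows-distinct b≢b'
    ... | i , differ = corner-geodesic (KAdj m n) _ ecol {x = inj₁ i} (b≢b' ∘ inj₂-injective) (λ ()) (λ ()) (λ ()) tt tt
                         (differ ∘ suc-injective , (λ ()) , (λ ()))

threshold : ∀ {m c} → Fin m → Fin m → Fin (suc (suc c))
threshold k i with i ≤? k
... | yes _ = suc zero
... | no  _ = zero

threshold-upto : ∀ {m c} {k i : Fin m} → i ≤ᶠ k → threshold {c = c} k i ≡ suc zero
threshold-upto {k = k} {i} i≤k with i ≤? k
... | yes _   = refl
... | no  i≰k = contradiction i≤k i≰k

threshold-diagonal : ∀ {m c} (k : Fin m) → threshold {c = c} k k ≡ suc zero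
threshold-diagonal k = threshold-upto (≤-reflexive refl)

threshold-above : ∀ {m c} {k i : Fin m} → k <ᶠ i → threshold {c = c} k i ≡ zero
threshold-above {k = k} {i} k<i with i ≤? k
... | yes i≤k = contradiction i≤k (<⇒≱ k<i)
... | no  _   = refl

zero≢one : ∀ {c} {x y : Fin (suc (suc c))} → x ≡ zero → y ≡ suc zero → x ≢ y
zero≢one refl refl ()

-- Distinct threshold words differ at the larger of the two indices.
threshold-rows-distinct : ∀ {m c} {k k' : Fin m} → k ≢ k' → ∃ λ i → threshold {c = c} k i ≢ threshold k' i
threshold-rows-distinct {k = k} {k'} k≢k' with <-cmp k k'
... | tri< k<k' _ _ = k' , zero≢one (threshold-above k<k') (threshold-diagonal k')
... | tri≈ _ k≡k' _ = contradiction k≡k' k≢k'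
... | tri> _ _ k'<k = k  , zero≢one (threshold-above k'<k) (threshold-diagonal k) ∘ sym

-- Distinct coordinates are distinguished by the threshold word of the smaller one.
threshold-columns-distinct : ∀ {m c} {i j : Fin m} → i ≢ j → ∃ λ k → threshold {c = c} k i ≢ threshold k j
threshold-columns-distinct {i = i} {j} i≢j with <-cmp i j
... | tri< i<j _ _ = i , zero≢one (threshold-above i<j) (threshold-diagonal i) ∘ sym
... | tri≈ _ i≡j _ = contradiction i≡j i≢j
... | tri> _ _ j<i = j , zero≢one (threshold-above j<i) (threshold-diagonal j)

-- For c ≥ 2 and m ≤ n ≤ c^m a separating matrix exists: the rows are the words
-- coded by 0, …, n-1, after swapping the codes of 0, …, m-1 with those of the
-- threshold words (which start with 1 and so have codes ≥ c^(m-1) ≥ m).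
separating-matrix : ∀ {m' c' n} → suc m' ≤ n → n ≤ suc (suc c') ^ suc m' → SeparatingMatrix (suc m') n (suc (suc c'))
separating-matrix {m'} {c'} {n} m≤n n≤N = record
  { entry            = entry
  ; rows-distinct    = rows-distinct
  ; columns-distinct = columns-distinct
  }
  where
    threshold-code : Fin (suc m') → Fin (suc (suc c') ^ suc m')
    threshold-code k = funToFin (threshold k)

    small-code : Fin (suc m') → Fin (suc (suc c') ^ suc m')
    small-code k = inject≤ k (≤-trans m≤n n≤N)

    threshold-code-injective : ∀ {k k'} → threshold-code k ≡ threshold-code k' → k ≡ k'
    threshold-code-injective {k} {k'} eq with k ≟ k'
    ... | yes k≡k' = k≡k'
    ... | no  k≢k' with threshold-rows-distinct k≢k'
    ... | i , differ = contradiction (funToFin-injective {f = threshold k} {g = threshold k'} eq i) differ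

    -- the two families of codes are disjoint: small codes are < m ≤ c^(m-1)
    small<threshold : ∀ k k' → toℕ (small-code k') < toℕ (threshold-code k)
    small<threshold k k' rewrite toℕ-inject≤ k' (≤-trans m≤n n≤N) =
      <-≤-trans (toℕ<n k')
        (≤-trans (<-pow (suc (suc c')) (s≤s (s≤s z≤n)) m')
                 (code-leading-one (threshold k) (threshold-upto {k = k} {i = zero} z≤n)))

    open Swap _≟_ threshold-code small-code threshold-code-injective
              (inject≤-injective _ _ _ _)
              (λ k k' eq → <ᶠ⇒≢ (small<threshold k k') (sym eq))

    entry : Fin n → Fin (suc m') → Fin (suc (suc c'))
    entry b = finToFun (swap (inject≤ b n≤N))

    rows-distinct : ∀ {b b'} → b ≢ b' → ∃ λ i → entry b i ≢ entry b' i
    rows-distinct b≢b' = finToFun-separates (b≢b' ∘ inject≤-injective _ _ _ _ ∘ swap-injective)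

    entry-small : ∀ k i → entry (inject≤ k m≤n) i ≡ threshold k i
    entry-small k i = trans (cong (λ x → finToFun (swap x) i) (inject≤-trans k m≤n n≤N))
                            (trans (cong (λ x → finToFun x i) (swap-g k)) (finToFun-funToFin (threshold k) i))

    columns-distinct : ∀ {i j} → i ≢ j → ∃ λ b → entry b i ≢ entry b j
    columns-distinct i≢j with threshold-columns-distinct i≢j
    ... | k , differ = inject≤ k m≤n , λ eq → differ (trans (sym (entry-small k _)) (trans eq (entry-small k _)))

-- The upper bound is the colouring from a separating matrix over Fin c (c ≥ 2
-- since 2 ≤ n ≤ c^m); the lower bound is the colour count of any colouring.
theorem3p7 : (m n : ℕ) → 2 ≤ m → m ≤ n → (c : ℕ) → IsCeilRoot m n c →
    StrcIs (KAdj m n) (suc c)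
theorem3p7 (suc (suc m'')) (suc (suc n'')) (s≤s (s≤s _)) m≤n@(s≤s (s≤s _)) c (n≤cᵐ , least)
  with base≥2 {c = c} (suc m'') (s≤s (s≤s z≤n)) n≤cᵐ
... | s≤s (s≤s _) = matrix-colouring (separating-matrix m≤n n≤cᵐ) , minimal
  where
    -- a colouring with k colours has k ≥ 2 and n ≤ (k-1)^m, so c ≤ k - 1
    minimal : ∀ k → Σ (TotalColouring (KAdj _ _) k) (IsSTRC (KAdj _ _)) → suc c ≤ k
    minimal k (col , strc) with at-least-two-colours col strc zero zero (suc zero) (λ ())
    ... | s≤s (s≤s _) = s≤s (least _ (colour-count col strc zero))
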